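{- For every $\tau\in\mathbb{T}_C$, the type $\bigcap\mathbb{P}(\tau)$ is organized and $\bigcap\mathbb{P}(\tau)=\tau$.
   Context: Types $\mathbb{T}_C$: $\tau::=a\mid\alpha\mid\omega\mid\tau_1\to\tau_2\mid\tau_1\cap\tau_2\mid c(\tau)$ ($a$ constants, $\alpha$ type variables, $c$ unary constructors). Subtyping: least preorder with $\sigma\le\omega$; $\omega\le\omega\to\omega$; $\sigma\cap\tau\le\sigma,\tau$; $\sigma\le\tau_1,\sigma\le\tau_2\Rightarrow\sigma\le\tau_1\cap\tau_2$; $(\sigma\to\tau_1)\cap(\sigma\to\tau_2)\le\sigma\to\tau_1\cap\tau_2$; $\sigma_2\le\sigma_1,\tau_1\le\tau_2\Rightarrow\sigma_1\to\tau_1\le\sigma_2\to\tau_2$; $\tau_1\le\tau_2\Rightarrow c(\tau_1)\le c(\tau_2)$; $c(\tau_1)\cap c(\tau_2)\le c(\tau_1\cap\tau_2)$; $=$ means mutual $\le$. Paths: $\pi::=a\mid\alpha\mid\sigma\to\pi\mid c(\omega)\mid c(\pi)$ ($\sigma$ any type). $\mathbb{P}(a)=\{a\}$, $\mathbb{P}(\alpha)=\{\alpha\}$, $\mathbb{P}(\omega)=\emptyset$, $\mathbb{P}(\sigma\to\tau)=\{\sigma\to\pi\mid\pi\in\mathbb{P}(\tau)\}$, $\mathbb{P}(\sigma\cap\tau)=\mathbb{P}(\sigma)\cup\mathbb{P}(\tau)$, $\mathbb{P}(c(\tau))=\{c(\omega)\}$ if $\mathbb{P}(\tau)=\emptyset$,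 else $\{c(\pi)\mid\pi\in\mathbb{P}(\tau)\}$. $\bigcap\mathbb{P}(\tau)$ denotes $\pi_1\cap\cdots\cap\pi_n$ where $\mathbb{P}(\tau)=\{\pi_1,\dots,\pi_n\}$, and $\omega$ if $\mathbb{P}(\tau)=\emptyset$. A type is organized if it is (syntactically) an intersection $\bigcap_{i\in I}\pi_i$ of paths. -}

module Defs where

open import Data.List using (List; []; _∷_; _++_; map)
open import Data.Product using (_×_)

data Ty (A V C : Set) : Set where
  const : A → Ty A V C
  var   : V → Ty A V C
  ω     : Ty A V C
  _⇒_   : Ty A V C → Ty A V C → Ty A V C
  _∩_   : Ty A V C → Ty A V C → Ty A V C
  con   : C → Ty A V C → Ty A V C

infixr 6 _⇒_
infixr 7 _∩_

module _ {A V C : Set} where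

  infix 4 _≤_ _≐_

  data _≤_ : Ty A V C → Ty A V C → Set where
    ≤-refl  : ∀ {σ} → σ ≤ σ
    ≤-trans : ∀ {σ τ ρ} → σ ≤ τ → τ ≤ ρ → σ ≤ ρ
    ≤-ω     : ∀ {σ} → σ ≤ ω
    ω≤ω⇒ω   : ω ≤ ω ⇒ ω
    ∩-≤ˡ    : ∀ {σ τ} → σ ∩ τ ≤ σ
    ∩-≤ʳ    : ∀ {σ τ} → σ ∩ τ ≤ τ
    ≤-∩     : ∀ {σ τ₁ τ₂} → σ ≤ τ₁ → σ ≤ τ₂ → σ ≤ τ₁ ∩ τ₂
    ⇒-∩     : ∀ {σ τ₁ τ₂} → (σ ⇒ τ₁) ∩ (σ ⇒ τ₂) ≤ σ ⇒ (τ₁ ∩ τ₂)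
    ⇒-mono  : ∀ {σ₁ σ₂ τ₁ τ₂} → σ₂ ≤ σ₁ → τ₁ ≤ τ₂ → σ₁ ⇒ τ₁ ≤ σ₂ ⇒ τ₂
    con-mono : ∀ {c τ₁ τ₂} → τ₁ ≤ τ₂ → con c τ₁ ≤ con c τ₂
    con-∩   : ∀ {c τ₁ τ₂} → con c τ₁ ∩ con c τ₂ ≤ con c (τ₁ ∩ τ₂)

  _≐_ : Ty A V C → Ty A V C → Set
  σ ≐ τ = (σ ≤ τ) × (τ ≤ σ)

  data IsPath : Ty A V C → Set where
    p-const : ∀ {a} → IsPath (const a)
    p-var   : ∀ {α} → IsPath (var α)
    p-⇒     : ∀ {σ π} → IsPath π → IsPath (σ ⇒ π)
    p-conω  : ∀ {c} → IsPath (con c ω)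
    p-con   : ∀ {c π} → IsPath π → IsPath (con c π)

  -- ℙ(τ), as a list (the finite set of paths, with a fixed enumeration order)
  ℙ : Ty A V C → List (Ty A V C)
  ℙ (const a) = const a ∷ []
  ℙ (var α)   = var α ∷ []
  ℙ ω         = []
  ℙ (σ ⇒ τ)   = map (σ ⇒_) (ℙ τ)
  ℙ (σ ∩ τ)   = ℙ σ ++ ℙ τ
  ℙ (con c τ) with ℙ τ
  ... | []     = con c ω ∷ []
  ... | p ∷ ps = map (con c) (p ∷ ps)

  ⋂ : List (Ty A V C) → Ty A V C
  ⋂ []           = ω
  ⋂ (π ∷ [])     = π
  ⋂ (π ∷ ρ ∷ ps) = π ∩ ⋂ (ρ ∷ ps)

  data IsPathInter : Ty A V C → Set where
    pi-path : ∀ {π} → IsPath π → IsPathInter π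
    pi-∩    : ∀ {σ τ} → IsPathInter σ → IsPathInter τ → IsPathInter (σ ∩ τ)

  data Organized : Ty A V C → Set where
    org-ω     : Organized ω
    org-inter : ∀ {τ} → IsPathInter τ → Organized τ

-- For the equation, ⋂ is a homomorphism from list concatenation to ∩, and
-- both σ ⇒ _ and con c distribute over ∩; σ ⇒ _ moreover fixes ω up to =,
-- which covers ℙ (σ ⇒ τ) = ∅, while ℙ (con c τ) = ∅ is handled by c(ω)
-- itself.
module Submission where

open import Defs
open import Data.Product using (_×_; _,_)
open import Data.List using (List; []; _∷_; _++_; map)
open import Data.List.Relation.Unary.All using (All; []; _∷_)
import Data.List.Relation.Unary.All as All
open import Data.List.Relation.Unary.All.Properties using (map⁺; ++⁺)
open import Relation.Binary.Bundles using (Setoid)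
open import Relation.Binary.Structures using (IsEquivalence)

module _ {A V C : Set} where

  private
    T : Set
    T = Ty A V C

  ≐-isEquivalence : IsEquivalence (_≐_ {A} {V} {C})
  ≐-isEquivalence = record
    { refl  = ≤-refl , ≤-refl
    ; sym   = λ (p , q) → q , p
    ; trans = λ (p , q) (r , s) → ≤-trans p r , ≤-trans s q
    }

  ≐-setoid : Setoid _ _
  ≐-setoid = record { isEquivalence = ≐-isEquivalence }

  open Setoid ≐-setoid using () renaming (refl to ≐-refl; sym to ≐-sym)
  open import Relation.Binary.Reasoning.Setoid ≐-setoid

  ∩-cong : {σ₁ σ₂ τ₁ τ₂ : T} → σ₁ ≐ σ₂ → τ₁ ≐ τ₂ → σ₁ ∩ τ₁ ≐ σ₂ ∩ τ₂
  ∩-cong (p , q) (r , s) = ≤-∩ (≤-trans ∩-≤ˡ p) (≤-trans ∩-≤ʳ r)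
                         , ≤-∩ (≤-trans ∩-≤ˡ q) (≤-trans ∩-≤ʳ s)

  ⇒-congʳ : {σ τ₁ τ₂ : T} → τ₁ ≐ τ₂ → σ ⇒ τ₁ ≐ σ ⇒ τ₂
  ⇒-congʳ (p , q) = ⇒-mono ≤-refl p , ⇒-mono ≤-refl q

  con-cong : {c : C} {τ₁ τ₂ : T} → τ₁ ≐ τ₂ → con c τ₁ ≐ con c τ₂
  con-cong (p , q) = con-mono p , con-mono q

  ∩-identityˡ : (τ : T) → ω ∩ τ ≐ τ
  ∩-identityˡ τ = ∩-≤ʳ , ≤-∩ ≤-ω ≤-refl

  ∩-identityʳ : (τ : T) → τ ∩ ω ≐ τ
  ∩-identityʳ τ = ∩-≤ˡ , ≤-∩ ≤-refl ≤-ω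

  ∩-assoc : (ρ σ τ : T) → (ρ ∩ σ) ∩ τ ≐ ρ ∩ (σ ∩ τ)
  ∩-assoc ρ σ τ = ≤-∩ (≤-trans ∩-≤ˡ ∩-≤ˡ) (≤-∩ (≤-trans ∩-≤ˡ ∩-≤ʳ) ∩-≤ʳ)
                , ≤-∩ (≤-∩ ∩-≤ˡ (≤-trans ∩-≤ʳ ∩-≤ˡ)) (≤-trans ∩-≤ʳ ∩-≤ʳ)

  ⇒-ω : (σ : T) → σ ⇒ ω ≐ ω
  ⇒-ω σ = ≤-ω , ≤-trans ω≤ω⇒ω (⇒-mono ≤-ω ≤-refl)

  ⇒-distribˡ-∩ : (σ τ₁ τ₂ : T) → σ ⇒ (τ₁ ∩ τ₂) ≐ (σ ⇒ τ₁) ∩ (σ ⇒ τ₂)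
  ⇒-distribˡ-∩ σ τ₁ τ₂ = ≤-∩ (⇒-mono ≤-refl ∩-≤ˡ) (⇒-mono ≤-refl ∩-≤ʳ) , ⇒-∩

  con-distrib-∩ : (c : C) (τ₁ τ₂ : T) → con c (τ₁ ∩ τ₂) ≐ con c τ₁ ∩ con c τ₂
  con-distrib-∩ c τ₁ τ₂ = ≤-∩ (con-mono ∩-≤ˡ) (con-mono ∩-≤ʳ) , con-∩

  ⋂-∷ : (τ : T) (τs : List T) → ⋂ (τ ∷ τs) ≐ τ ∩ ⋂ τs
  ⋂-∷ τ []       = ≐-sym (∩-identityʳ τ)
  ⋂-∷ τ (_ ∷ _) = ≐-refl

  ⋂-++ : (σs τs : List T) → ⋂ (σs ++ τs) ≐ ⋂ σs ∩ ⋂ τs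
  ⋂-++ []       τs = ≐-sym (∩-identityˡ (⋂ τs))
  ⋂-++ (σ ∷ σs) τs = begin
    ⋂ (σ ∷ σs ++ τs)       ≈⟨ ⋂-∷ σ (σs ++ τs) ⟩
    σ ∩ ⋂ (σs ++ τs)       ≈⟨ ∩-cong ≐-refl (⋂-++ σs τs) ⟩
    σ ∩ (⋂ σs ∩ ⋂ τs)      ≈⟨ ∩-assoc σ (⋂ σs) (⋂ τs) ⟨
    (σ ∩ ⋂ σs) ∩ ⋂ τs      ≈⟨ ∩-cong (⋂-∷ σ σs) ≐-refl ⟨
    ⋂ (σ ∷ σs) ∩ ⋂ τs      ∎

  ⋂-map-∷ : (f : T → T) → (∀ σ τ → f (σ ∩ τ) ≐ f σ ∩ f τ) →
           (τ : T) (τs : List T) → ⋂ (map f (τ ∷ τs)) ≐ f (⋂ (τ ∷ τs))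
  ⋂-map-∷ f f-∩ τ []       = ≐-refl
  ⋂-map-∷ f f-∩ τ (ρ ∷ ρs) = begin
    f τ ∩ ⋂ (map f (ρ ∷ ρs))  ≈⟨ ∩-cong ≐-refl (⋂-map-∷ f f-∩ ρ ρs) ⟩
    f τ ∩ f (⋂ (ρ ∷ ρs))      ≈⟨ f-∩ τ (⋂ (ρ ∷ ρs)) ⟨
    f (τ ∩ ⋂ (ρ ∷ ρs))        ∎

  ⋂-map-⇒ : (σ : T) (τs : List T) → ⋂ (map (σ ⇒_) τs) ≐ σ ⇒ ⋂ τs
  ⋂-map-⇒ σ []       = ≐-sym (⇒-ω σ)
  ⋂-map-⇒ σ (τ ∷ τs) = ⋂-map-∷ (σ ⇒_) (⇒-distribˡ-∩ σ) τ τs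

  ⋂-organized : (πs : List T) → All IsPath πs → Organized (⋂ πs)
  ⋂-organized []       []       = org-ω
  ⋂-organized (π ∷ πs) (p ∷ ps) = org-inter (pathInter π πs p ps)
    where
      pathInter : (π : T) (πs : List T) → IsPath π → All IsPath πs →
                  IsPathInter (⋂ (π ∷ πs))
      pathInter π []       p []       = pi-path p
      pathInter π (ρ ∷ ρs) p (q ∷ qs) = pi-∩ (pi-path p) (pathInter ρ ρs q qs)

  ℙ-paths : (τ : T) → All IsPath (ℙ τ)
  ℙ-paths (const a) = p-const ∷ []
  ℙ-paths (var α)   = p-var ∷ []
  ℙ-paths ω         = []
  ℙ-paths (σ ⇒ τ)   = map⁺ (All.map p-⇒ (ℙ-paths τ))
  ℙ-paths (σ ∩ τ)   = ++⁺ (ℙ-paths σ) (ℙ-paths τ)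
  ℙ-paths (con c τ) with ℙ τ | ℙ-paths τ
  ... | []     | _  = p-conω ∷ []
  ... | _ ∷ _ | ps = map⁺ (All.map p-con ps)

  ⋂-ℙ : (τ : T) → ⋂ (ℙ τ) ≐ τ
  ⋂-ℙ (const a) = ≐-refl
  ⋂-ℙ (var α)   = ≐-refl
  ⋂-ℙ ω         = ≐-refl
  ⋂-ℙ (σ ⇒ τ)   = begin
    ⋂ (map (σ ⇒_) (ℙ τ))  ≈⟨ ⋂-map-⇒ σ (ℙ τ) ⟩
    σ ⇒ ⋂ (ℙ τ)           ≈⟨ ⇒-congʳ (⋂-ℙ τ) ⟩
    σ ⇒ τ                 ∎
  ⋂-ℙ (σ ∩ τ)   = begin
    ⋂ (ℙ σ ++ ℙ τ)        ≈⟨ ⋂-++ (ℙ σ) (ℙ τ) ⟩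
    ⋂ (ℙ σ) ∩ ⋂ (ℙ τ)     ≈⟨ ∩-cong (⋂-ℙ σ) (⋂-ℙ τ) ⟩
    σ ∩ τ                 ∎
  ⋂-ℙ (con c τ) with ℙ τ | ⋂-ℙ τ
  ... | []     | e = con-cong e
  ... | π ∷ πs | e = begin
    ⋂ (map (con c) (π ∷ πs))  ≈⟨ ⋂-map-∷ (con c) (con-distrib-∩ c) π πs ⟩
    con c (⋂ (π ∷ πs))        ≈⟨ con-cong e ⟩
    con c τ                   ∎

lemma4p8 : {A V C : Set} (τ : Ty A V C) → Organized (⋂ (ℙ τ)) × (⋂ (ℙ τ) ≐ τ)
lemma4p8 τ = ⋂-organized (ℙ τ) (ℙ-paths τ) , ⋂-ℙ τ
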